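{- Let $X$ be a GOGAm triangle of size $n$. (i) Let $1\le k\le n$. The triangle obtained from $X$ by replacing every entry $X_{i,j}$ with $n\ge i\ge j+k$ by $1$ is a GOGAm triangle. (ii) Let $n\ge m\ge k\ge 1$. Assume that for every $i$ with $n\ge i\ge m+1$, $X$ is constant on the partial SW-NE diagonal $(X_{i+l,k+l})_{0\le l\le n-i}$. Then the triangle obtained from $X$ by replacing the entries $X_{m+l,k+l}$, for $1\le l\le n-m$, by $X_{m,k}$ is a GOGAm triangle.
   Context: A Gelfand-Tsetlin triangle of size $n$ is an array $X=(X_{i,j})_{n\ge i\ge j\ge 1}$ of positive integers with $X_{i+1,j}\le X_{i,j}\le X_{i+1,j+1}$ for $n-1\ge i\ge j\ge1$. A GOGAm triangle of size $n$ is a Gelfand-Tsetlin triangle such that $X_{n,n}\le n$ and the following holds for every $1\le k\le n-1$ and every sequence of integers $n=j_0>j_1>\dots>j_{n-k}\ge 1$: $$\sum_{i=0}^{n-k-1}\bigl(X_{j_i+i,\,j_i}-X_{j_{i+1}+i,\,j_{i+1}}\bigr)+X_{j_{n-k}+n-k,\,j_{n-k}}\le k.$$ -}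

module Defs where

open import Data.Nat using (ℕ; zero; suc; _+_; _∸_; _≤_; _<_; _≤?_; _<?_; _≟_)
open import Data.Integer as ℤ using (ℤ; +_)
open import Data.Product using (_×_)
open import Relation.Nullary using (does)
open import Relation.Nullary.Decidable using (_×-dec_)
open import Relation.Binary.PropositionalEquality using (_≡_)
open import Data.Bool using (if_then_else_)

-- A triangle is given by its entries X i j; only the entries with
-- n ≥ i ≥ j ≥ 1 are relevant (all conditions below only look at those).
Triangle : Set
Triangle = ℕ → ℕ → ℕ

sumZ : ℕ → (ℕ → ℤ) → ℤ
sumZ zero    f = + 0
sumZ (suc m) f = sumZ m f ℤ.+ f m

IsGT : ℕ → Triangle → Set
IsGT n X =
  (∀ i j → 1 ≤ j → j ≤ i → i ≤ n → 1 ≤ X i j) ×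
  (∀ i j → 1 ≤ j → j ≤ i → suc i ≤ n →
     (X (suc i) j ≤ X i j) × (X i j ≤ X (suc i) (suc j)))

gogamLHS : ℕ → Triangle → ℕ → (ℕ → ℕ) → ℤ
gogamLHS n X k js =
  sumZ (n ∸ k) (λ i → + X (js i + i) (js i) ℤ.- + X (js (suc i) + i) (js (suc i)))
  ℤ.+ + X (js (n ∸ k) + (n ∸ k)) (js (n ∸ k))

IsGOGAm : ℕ → Triangle → Set
IsGOGAm n X =
  IsGT n X ×
  (X n n ≤ n) ×
  (∀ k → 1 ≤ k → k ≤ n ∸ 1 →
     ∀ (js : ℕ → ℕ) → js 0 ≡ n →
       (∀ i → i < n ∸ k → js (suc i) < js i) →
       1 ≤ js (n ∸ k) →
       gogamLHS n X k js ℤ.≤ + k)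

cutTriangle : ℕ → Triangle → Triangle
cutTriangle k X i j = if does (j + k ≤? i) then 1 else X i j

-- (ii): replace the entries X_{m+l,k+l}, 1 ≤ l ≤ n-m, by X_{m,k}.
-- (i,j) is such an entry iff m < i ≤ n and j = k + (i - m).
diagReplace : ℕ → ℕ → ℕ → Triangle → Triangle
diagReplace n m k X i j =
  if does ((m <? i) ×-dec ((i ≤? n) ×-dec (k + (i ∸ m) ≟ j))) then X m k else X i j

module Submission where

-- Write X (j + i) j for the entry in column j at offset i (row minus
-- column).  The i-th summand of a GOGAm sum along js compares the entries
-- at offset i in the columns js (i+1) < js i; in a Gelfand-Tsetlin triangle
-- entries grow along each offset diagonal, so such summands are ≥ 0.
--
-- For both operations the new triangle Y is first checked to be
-- Gelfand-Tsetlin with Y n n ≤ n; then every GOGAm sum of Y is shown to be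
-- dominated by a GOGAm sum of X for an admissible sequence (`inheritGOGAm`).
--  (ii) The replaced cells form the part of one offset diagonal beyond (m,k)
--       and receive X m k, which is at most their old values.  Along the same
--       sequence, each summand and the final entry of Y are bounded by those
--       of X.
--  (i)  Entries at offset ≥ c become 1.  If the sequence never reaches offset
--       c nothing changes.  Otherwise the summands from offset c on vanish and
--       the final entry is 1; following the sequence up to step c and then
--       descending one column per step (`straightenAfter`) gives an admissible
--       sequence whose X-sum is at least as large: its extra summands are ≥ 0
--       and its final entry is ≥ 1.

open import Defs
open import Data.Nat
  using (ℕ; zero; suc; _+_; _∸_; _≤_; _<_; _⊓_; _≤′_; ≤′-refl; ≤′-step; _≤?_; _<?_; _≟_; s≤s; z≤n)
open import Data.Nat.Properties
open import Data.Integer as ℤ using (ℤ; +_; +≤+)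
import Data.Integer.Properties as ℤP
open import Data.Product using (Σ; _×_; _,_; proj₁; proj₂)
open import Data.Sum using (inj₁; inj₂)
open import Data.Empty using (⊥-elim)
open import Relation.Nullary using (¬_; Dec; yes; no; does)
open import Relation.Nullary.Decidable using (_×-dec_; dec-true; dec-false)
open import Relation.Binary.PropositionalEquality
  using (_≡_; refl; sym; trans; cong; cong₂; subst; subst₂; module ≡-Reasoning)
open import Data.Bool using (if_then_else_)

if-yes : {P : Set} (d : Dec P) {a b : ℕ} → P → (if does d then a else b) ≡ a
if-yes d p rewrite dec-true d p = refl

if-no : {P : Set} (d : Dec P) {a b : ℕ} → ¬ P → (if does d then a else b) ≡ b
if-no d ¬p rewrite dec-false d ¬p = refl

sumZ-cong : ∀ c {f g : ℕ → ℤ} → (∀ i → i < c → f i ≡ g i) → sumZ c f ≡ sumZ c g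
sumZ-cong zero    eq = refl
sumZ-cong (suc c) eq =
  cong₂ ℤ._+_ (sumZ-cong c (λ i i<c → eq i (m<n⇒m<1+n i<c))) (eq c (n<1+n c))

sumZ-mono : ∀ c {f g : ℕ → ℤ} → (∀ i → i < c → f i ℤ.≤ g i) → sumZ c f ℤ.≤ sumZ c g
sumZ-mono zero    le = ℤP.≤-refl
sumZ-mono (suc c) le =
  ℤP.+-mono-≤ (sumZ-mono c (λ i i<c → le i (m<n⇒m<1+n i<c))) (le c (n<1+n c))

sumZ-zeroTail : ∀ {c M} (f : ℕ → ℤ) → c ≤ M →
  (∀ i → c ≤ i → i < M → f i ≡ + 0) → sumZ M f ≡ sumZ c f
sumZ-zeroTail {c} f c≤M vanish = go (≤⇒≤′ c≤M) vanish
  where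
  open ≡-Reasoning
  go : ∀ {M} → c ≤′ M → (∀ i → c ≤ i → i < M → f i ≡ + 0) → sumZ M f ≡ sumZ c f
  go ≤′-refl _ = refl
  go {suc M} (≤′-step c≤′M) vanish = begin
    sumZ M f ℤ.+ f M  ≡⟨ cong (λ x → sumZ M f ℤ.+ x) (vanish M (≤′⇒≤ c≤′M) (n<1+n M)) ⟩
    sumZ M f ℤ.+ + 0  ≡⟨ ℤP.+-identityʳ (sumZ M f) ⟩
    sumZ M f          ≡⟨ go c≤′M (λ i c≤i i<M → vanish i c≤i (m<n⇒m<1+n i<M)) ⟩
    sumZ c f          ∎

sumZ-nonnegTail : ∀ {c M} (f : ℕ → ℤ) → c ≤ M →
  (∀ i → c ≤ i → i < M → + 0 ℤ.≤ f i) → sumZ c f ℤ.≤ sumZ M f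
sumZ-nonnegTail {c} f c≤M nonneg = go (≤⇒≤′ c≤M) nonneg
  where
  open ℤP.≤-Reasoning
  go : ∀ {M} → c ≤′ M → (∀ i → c ≤ i → i < M → + 0 ℤ.≤ f i) → sumZ c f ℤ.≤ sumZ M f
  go ≤′-refl _ = ℤP.≤-refl
  go {suc M} (≤′-step c≤′M) nonneg = begin
    sumZ c f          ≤⟨ go c≤′M (λ i c≤i i<M → nonneg i c≤i (m<n⇒m<1+n i<M)) ⟩
    sumZ M f          ≡⟨ ℤP.+-identityʳ (sumZ M f) ⟨
    sumZ M f ℤ.+ + 0  ≤⟨ ℤP.+-monoʳ-≤ (sumZ M f) (nonneg M (≤′⇒≤ c≤′M) (n<1+n M)) ⟩
    sumZ M f ℤ.+ f M  ∎

record Admissible (n N : ℕ) (js : ℕ → ℕ) : Set where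
  field
    start      : js 0 ≡ n
    descending : ∀ i → i < N → js (suc i) < js i
    positive   : 1 ≤ js N

  drop : ∀ i t → i + t ≤ N → js (i + t) + t ≤ js i
  drop i zero    _     = ≤-reflexive (trans (+-identityʳ _) (cong js (+-identityʳ i)))
  drop i (suc t) i+1+t≤N = begin
    js (i + suc t) + suc t      ≡⟨ cong (λ j → js j + suc t) (+-suc i t) ⟩
    js (suc (i + t)) + suc t    ≡⟨ +-suc (js (suc (i + t))) t ⟩
    suc (js (suc (i + t)) + t)  ≤⟨ +-monoˡ-≤ t (descending (i + t) i+t<N′) ⟩
    js (i + t) + t              ≤⟨ drop i t (<⇒≤ i+t<N′) ⟩
    js i                        ∎
    where
    open ≤-Reasoning
    i+t<N′ : i + t < N
    i+t<N′ = subst (_≤ N) (+-suc i t) i+1+t≤N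

  inRows : ∀ i → i ≤ N → js i + i ≤ n
  inRows i i≤N = subst (js i + i ≤_) start (drop 0 i i≤N)

  room : ∀ i → i ≤ N → suc (N ∸ i) ≤ js i
  room i i≤N = begin
    1 + (N ∸ i)                 ≤⟨ +-monoˡ-≤ (N ∸ i) positive ⟩
    js N + (N ∸ i)              ≡⟨ cong (λ j → js j + (N ∸ i)) (m+[n∸m]≡n i≤N) ⟨
    js (i + (N ∸ i)) + (N ∸ i)  ≤⟨ drop i (N ∸ i) (≤-reflexive (m+[n∸m]≡n i≤N)) ⟩
    js i                        ∎
    where open ≤-Reasoning

  columnPositive : ∀ i → i ≤ N → 1 ≤ js i
  columnPositive i i≤N = ≤-trans (s≤s z≤n) (room i i≤N)

straightenAfter : ℕ → (ℕ → ℕ) → ℕ → ℕ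
straightenAfter c js i = js (i ⊓ c) ∸ (i ∸ c)

module Straighten {n N js} (adm : Admissible n N js) {c} (c≤N : c ≤ N) where
  open Admissible adm

  js′ : ℕ → ℕ
  js′ = straightenAfter c js

  head : ∀ {i} → i ≤ c → js′ i ≡ js i
  head i≤c rewrite m≤n⇒m⊓n≡m i≤c | m≤n⇒m∸n≡0 i≤c = refl

  tail : ∀ {i} → c ≤ i → js′ i ≡ js c ∸ (i ∸ c)
  tail c≤i rewrite m≥n⇒m⊓n≡n c≤i = refl

  unitStep : ∀ {i} → c ≤ i → i < N → js′ i ≡ suc (js′ (suc i))
  unitStep {i} c≤i i<N = begin
    js′ i                     ≡⟨ tail c≤i ⟩
    js c ∸ (i ∸ c)            ≡⟨ +-∸-assoc 1 enough ⟩
    suc (js c ∸ suc (i ∸ c))  ≡⟨ cong (λ t → suc (js c ∸ t)) (+-∸-assoc 1 c≤i) ⟨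
    suc (js c ∸ (suc i ∸ c))  ≡⟨ cong suc (tail (m≤n⇒m≤1+n c≤i)) ⟨
    suc (js′ (suc i))         ∎
    where
    open ≡-Reasoning
    enough : suc (i ∸ c) ≤ js c
    enough = ≤-trans (∸-monoˡ-< i<N c≤i) (≤-trans (n≤1+n _) (room c c≤N))

  admissible : Admissible n N js′
  admissible = record
    { start = trans (head z≤n) start ; descending = descending′ ; positive = positive′ }
    where
    descending′ : ∀ i → i < N → js′ (suc i) < js′ i
    descending′ i i<N with suc i ≤? c
    ... | yes i<c = subst₂ _<_ (sym (head i<c)) (sym (head (<⇒≤ i<c))) (descending i i<N)
    ... | no  i≮c = ≤-reflexive (sym (unitStep (≤-pred (≰⇒> i≮c)) i<N))
    positive′ : 1 ≤ js′ N
    positive′ = subst (1 ≤_) (sym (tail c≤N)) (m<n⇒0<n∸m (room c c≤N))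

-- The i-th summand of the GOGAm sum of X along js, and its final entry;
-- `gogamLHS n X k js` is `sumZ (n ∸ k) (summand X js) ℤ.+ final X js (n ∸ k)`.
summand : Triangle → (ℕ → ℕ) → ℕ → ℤ
summand X js i = + X (js i + i) (js i) ℤ.- + X (js (suc i) + i) (js (suc i))

final : Triangle → (ℕ → ℕ) → ℕ → ℤ
final X js N = + X (js N + N) (js N)

summand-cong : ∀ X {js js′ : ℕ → ℕ} {i} → js i ≡ js′ i → js (suc i) ≡ js′ (suc i) →
  summand X js i ≡ summand X js′ i
summand-cong X {i = i} = cong₂ (λ p q → + X (p + i) p ℤ.- + X (q + i) q)

gogamLHS-mono : ∀ n k js {X Y} →
  (∀ i → i < n ∸ k → summand Y js i ℤ.≤ summand X js i) →
  final Y js (n ∸ k) ℤ.≤ final X js (n ∸ k) →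
  gogamLHS n Y k js ℤ.≤ gogamLHS n X k js
gogamLHS-mono n k js summands last = ℤP.+-mono-≤ (sumZ-mono (n ∸ k) summands) last

module GT {n X} (gt : IsGT n X) where
  positive : ∀ i j → 1 ≤ j → j ≤ i → i ≤ n → 1 ≤ X i j
  positive = proj₁ gt

  down : ∀ i j → 1 ≤ j → j ≤ i → suc i ≤ n → X (suc i) j ≤ X i j
  down i j 1≤j j≤i i<n = proj₁ (proj₂ gt i j 1≤j j≤i i<n)

  up : ∀ i j → 1 ≤ j → j ≤ i → suc i ≤ n → X i j ≤ X (suc i) (suc j)
  up i j 1≤j j≤i i<n = proj₂ (proj₂ gt i j 1≤j j≤i i<n)

  alongDiagonal : ∀ i {q p} → 1 ≤ q → q ≤ p → p + i ≤ n → X (q + i) q ≤ X (p + i) p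
  alongDiagonal i {q} 1≤q q≤p = go (≤⇒≤′ q≤p)
    where
    go : ∀ {p} → q ≤′ p → p + i ≤ n → X (q + i) q ≤ X (p + i) p
    go ≤′-refl _ = ≤-refl
    go {suc p} (≤′-step q≤′p) p+i<n =
      ≤-trans (go q≤′p (<⇒≤ p+i<n))
              (up (p + i) p (≤-trans 1≤q (≤′⇒≤ q≤′p)) (m≤m+n p i) p+i<n)

  unitStep-nonneg : ∀ {js : ℕ → ℕ} {i} → js i ≡ suc (js (suc i)) →
    1 ≤ js (suc i) → js i + i ≤ n → + 0 ℤ.≤ summand X js i
  unitStep-nonneg {js} {i} unit 1≤q inTriangle = ℤP.i≤j⇒0≤j-i (+≤+ grows)
    where
    q = js (suc i)
    grows : X (q + i) q ≤ X (js i + i) (js i)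
    grows = subst (λ p → X (q + i) q ≤ X (p + i) p) (sym unit)
              (up (q + i) q 1≤q (m≤m+n q i) (subst (λ p → p + i ≤ n) unit inTriangle))

Dominated : ℕ → Triangle → Triangle → Set
Dominated n Y X = ∀ k js → Admissible n (n ∸ k) js →
  Σ (ℕ → ℕ) λ js′ → Admissible n (n ∸ k) js′ × gogamLHS n Y k js ℤ.≤ gogamLHS n X k js′

inheritGOGAm : ∀ {n X Y} → IsGOGAm n X → IsGT n Y → Y n n ≤ n → Dominated n Y X → IsGOGAm n Y
inheritGOGAm {n} {X} {Y} (_ , _ , boundX) gtY topY dom = gtY , topY , boundY
  where
  boundY : ∀ k → 1 ≤ k → k ≤ n ∸ 1 → ∀ js → js 0 ≡ n →
    (∀ i → i < n ∸ k → js (suc i) < js i) → 1 ≤ js (n ∸ k) → gogamLHS n Y k js ℤ.≤ + k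
  boundY k 1≤k k≤n js s d p with dom k js (record { start = s ; descending = d ; positive = p })
  ... | js′ , adm′ , Y≤X = ℤP.≤-trans Y≤X (boundX k 1≤k k≤n js′ start descending positive)
    where open Admissible adm′

module DiagonalReplacement {n X} (gog : IsGOGAm n X) {m k}
  (k≤m : k ≤ m) (m≤n : m ≤ n) (1≤k : 1 ≤ k)
  (constant : (i : ℕ) → 1 + m ≤ i → i ≤ n → (l : ℕ) → l ≤ n ∸ i → X (i + l) (k + l) ≡ X i k) where
  open GT (proj₁ gog)

  Y : Triangle
  Y = diagReplace n m k X

  Replaced : ℕ → ℕ → Set
  Replaced i j = m < i × i ≤ n × k + (i ∸ m) ≡ j

  replaced? : ∀ i j → Dec (Replaced i j)
  replaced? i j = (m <? i) ×-dec ((i ≤? n) ×-dec (k + (i ∸ m) ≟ j))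

  Y-replaced : ∀ {i j} → Replaced i j → Y i j ≡ X m k
  Y-replaced {i} {j} = if-yes (replaced? i j)

  Y-kept : ∀ {i j} → ¬ Replaced i j → Y i j ≡ X i j
  Y-kept {i} {j} = if-no (replaced? i j)

  nextRow : ∀ {i} → m ≤ i → k + (suc i ∸ m) ≡ suc (k + (i ∸ m))
  nextRow {i} m≤i = trans (cong (_+_ k) (+-∸-assoc 1 m≤i)) (+-suc k (i ∸ m))

  replaced-offset : ∀ {i j} → Replaced i j → i ≡ j + (m ∸ k)
  replaced-offset {i} {j} (m<i , _ , on) = begin
    i                          ≡⟨ m+[n∸m]≡n (<⇒≤ m<i) ⟨
    m + (i ∸ m)                ≡⟨ cong (_+ (i ∸ m)) (m+[n∸m]≡n k≤m) ⟨
    k + (m ∸ k) + (i ∸ m)      ≡⟨ +-assoc k (m ∸ k) (i ∸ m) ⟩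
    k + ((m ∸ k) + (i ∸ m))    ≡⟨ cong (_+_ k) (+-comm (m ∸ k) (i ∸ m)) ⟩
    k + ((i ∸ m) + (m ∸ k))    ≡⟨ +-assoc k (i ∸ m) (m ∸ k) ⟨
    k + (i ∸ m) + (m ∸ k)      ≡⟨ cong (_+ (m ∸ k)) on ⟩
    j + (m ∸ k)                ∎
    where open ≡-Reasoning

  belowReplaced : ∀ {i j} → Replaced i j → X m k ≤ X i j
  belowReplaced {i} {j} r@(_ , i≤n , on) =
    subst₂ (λ a b → X a k ≤ X b j) (m+[n∸m]≡n k≤m) (sym (replaced-offset r))
      (alongDiagonal (m ∸ k) 1≤k (subst (k ≤_) on (m≤m+n k (i ∸ m)))
                     (subst (_≤ n) (replaced-offset r) i≤n))

  Y≤X : ∀ i j → Y i j ≤ X i j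
  Y≤X i j with replaced? i j
  ... | yes r = subst (_≤ X i j) (sym (Y-replaced r)) (belowReplaced r)
  ... | no ¬r = ≤-reflexive (Y-kept ¬r)

  replaced-step : ∀ {i j} → Replaced i j → suc i ≤ n → Replaced (suc i) (suc j)
  replaced-step (m<i , _ , on) i<n = m<n⇒m<1+n m<i , i<n , trans (nextRow (<⇒≤ m<i)) (cong suc on)

  replaced-along : ∀ i {q p} → Replaced (q + i) q → q ≤ p → p + i ≤ n → Replaced (p + i) p
  replaced-along i {q} r q≤p = go (≤⇒≤′ q≤p)
    where
    go : ∀ {p} → q ≤′ p → p + i ≤ n → Replaced (p + i) p
    go ≤′-refl _ = r
    go {suc p} (≤′-step q≤′p) p+i<n = replaced-step (go q≤′p (<⇒≤ p+i<n)) p+i<n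

  replaced-start : ∀ {i j} → Replaced (suc i) (suc j) → ¬ Replaced i j → i ≡ m × j ≡ k
  replaced-start {i} {j} (m<1+i , i<n , on) ¬r with m≤n⇒m<n∨m≡n (≤-pred m<1+i)
  ... | inj₁ m<i  = ⊥-elim (¬r (m<i , <⇒≤ i<n , suc-injective (trans (sym (nextRow (<⇒≤ m<i))) on)))
  ... | inj₂ refl = refl , sym (suc-injective (begin
    suc k                ≡⟨ cong suc (+-identityʳ k) ⟨
    suc (k + 0)          ≡⟨ cong (λ t → suc (k + t)) (n∸n≡0 m) ⟨
    suc (k + (m ∸ m))    ≡⟨ nextRow ≤-refl ⟨
    k + (suc m ∸ m)      ≡⟨ on ⟩
    suc j                ∎))
    where open ≡-Reasoning

  -- The cell directly below a replaced cell keeps a value ≤ X m k: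
  -- it lies on the diagonal of (m + 1, k), on which X is constant.
  belowReplacedCell : ∀ {i j} → Replaced i j → suc i ≤ n → Y (suc i) j ≤ X m k
  belowReplacedCell {i} {j} (m<i , i≤n , on) i<n with replaced? (suc i) j
  ... | yes r′ = ≤-reflexive (Y-replaced r′)
  ... | no ¬r′ = begin
    Y (suc i) j  ≡⟨ Y-kept ¬r′ ⟩
    X (suc i) j  ≡⟨ subst₂ (λ a b → X a b ≡ X (suc m) k) (cong suc (m+[n∸m]≡n (<⇒≤ m<i))) on
                      (constant (suc m) ≤-refl 1+m≤n (i ∸ m) (∸-monoˡ-≤ (suc m) i<n)) ⟩
    X (suc m) k  ≤⟨ down m k 1≤k k≤m 1+m≤n ⟩
    X m k        ∎
    where
    open ≤-Reasoning
    1+m≤n : suc m ≤ n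
    1+m≤n = ≤-trans m<i i≤n

  swOfReplaced : ∀ {i j} → Replaced (suc i) (suc j) → Y i j ≤ X m k
  swOfReplaced {i} {j} r′ with replaced? i j
  ... | yes r = ≤-reflexive (Y-replaced r)
  ... | no ¬r with replaced-start r′ ¬r
  ...   | refl , refl = ≤-reflexive (Y-kept ¬r)

  isGT : IsGT n Y
  isGT = positiveY , λ i j 1≤j j≤i i<n → downY i j 1≤j j≤i i<n , upY i j 1≤j j≤i i<n
    where
    positiveY : ∀ i j → 1 ≤ j → j ≤ i → i ≤ n → 1 ≤ Y i j
    positiveY i j 1≤j j≤i i≤n with replaced? i j
    ... | yes r = subst (1 ≤_) (sym (Y-replaced r)) (positive m k 1≤k k≤m m≤n)
    ... | no ¬r = subst (1 ≤_) (sym (Y-kept ¬r)) (positive i j 1≤j j≤i i≤n)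
    downY : ∀ i j → 1 ≤ j → j ≤ i → suc i ≤ n → Y (suc i) j ≤ Y i j
    downY i j 1≤j j≤i i<n with replaced? i j
    ... | yes r = subst (Y (suc i) j ≤_) (sym (Y-replaced r)) (belowReplacedCell r i<n)
    ... | no ¬r = subst (Y (suc i) j ≤_) (sym (Y-kept ¬r))
                    (≤-trans (Y≤X (suc i) j) (down i j 1≤j j≤i i<n))
    upY : ∀ i j → 1 ≤ j → j ≤ i → suc i ≤ n → Y i j ≤ Y (suc i) (suc j)
    upY i j 1≤j j≤i i<n with replaced? (suc i) (suc j)
    ... | yes r′ = subst (Y i j ≤_) (sym (Y-replaced r′)) (swOfReplaced r′)
    ... | no ¬r′ = subst₂ _≤_ (sym (Y-kept (λ r → ¬r′ (replaced-step r i<n)))) (sym (Y-kept ¬r′))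
                     (up i j 1≤j j≤i i<n)

  offsetDifference : ∀ i {q p} → 1 ≤ q → q ≤ p → p + i ≤ n →
    + Y (p + i) p ℤ.- + Y (q + i) q ℤ.≤ + X (p + i) p ℤ.- + X (q + i) q
  offsetDifference i {q} {p} 1≤q q≤p p+i≤n with replaced? (p + i) p | replaced? (q + i) q
  ... | yes rp | yes rq rewrite Y-replaced rp | Y-replaced rq =
    ℤP.≤-trans (ℤP.≤-reflexive (ℤP.+-inverseʳ (+ X m k)))
               (ℤP.i≤j⇒0≤j-i (+≤+ (alongDiagonal i 1≤q q≤p p+i≤n)))
  ... | yes rp | no ¬rq rewrite Y-replaced rp | Y-kept ¬rq =
    ℤP.+-monoˡ-≤ (ℤ.- + X (q + i) q) (+≤+ (belowReplaced rp))
  ... | no ¬rp | yes rq = ⊥-elim (¬rp (replaced-along i rq q≤p p+i≤n))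
  ... | no ¬rp | no ¬rq rewrite Y-kept ¬rp | Y-kept ¬rq = ℤP.≤-refl

  domination : Dominated n Y X
  domination r js adm = js , adm , gogamLHS-mono n r js {X} {Y} summands (+≤+ (Y≤X _ _))
    where
    open Admissible adm
    summands : ∀ i → i < n ∸ r → summand Y js i ℤ.≤ summand X js i
    summands i i<N = offsetDifference i (columnPositive (suc i) i<N) (<⇒≤ (descending i i<N))
                                        (inRows i (<⇒≤ i<N))

  isGOGAm : IsGOGAm n Y
  isGOGAm = inheritGOGAm gog isGT (≤-trans (Y≤X n n) (proj₁ (proj₂ gog))) domination

module Cut {n X} (gog : IsGOGAm n X) {c} (1≤c : 1 ≤ c) where
  open GT (proj₁ gog)

  Y : Triangle
  Y = cutTriangle c X

  Y-cut : ∀ {i j} → j + c ≤ i → Y i j ≡ 1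
  Y-cut {i} {j} = if-yes (j + c ≤? i)

  Y-kept : ∀ {i j} → ¬ (j + c ≤ i) → Y i j ≡ X i j
  Y-kept {i} {j} = if-no (j + c ≤? i)

  atOffset-cut : ∀ j {i} → c ≤ i → Y (j + i) j ≡ 1
  atOffset-cut j c≤i = Y-cut (+-monoʳ-≤ j c≤i)

  atOffset-kept : ∀ j {i} → i < c → Y (j + i) j ≡ X (j + i) j
  atOffset-kept j {i} i<c = Y-kept (λ cut → <⇒≱ i<c (+-cancelˡ-≤ j c i cut))

  isGT : IsGT n Y
  isGT = positiveY , λ i j 1≤j j≤i i<n → downY i j 1≤j j≤i i<n , upY i j 1≤j j≤i i<n
    where
    positiveY : ∀ i j → 1 ≤ j → j ≤ i → i ≤ n → 1 ≤ Y i j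
    positiveY i j 1≤j j≤i i≤n with j + c ≤? i
    ... | yes cut = ≤-reflexive (sym (Y-cut cut))
    ... | no ¬cut = subst (1 ≤_) (sym (Y-kept ¬cut)) (positive i j 1≤j j≤i i≤n)
    -- the cut region is closed under going down a row
    downY : ∀ i j → 1 ≤ j → j ≤ i → suc i ≤ n → Y (suc i) j ≤ Y i j
    downY i j 1≤j j≤i i<n with j + c ≤? suc i
    ... | yes cut = subst (_≤ Y i j) (sym (Y-cut cut)) (positiveY i j 1≤j j≤i (<⇒≤ i<n))
    ... | no ¬cut = subst₂ _≤_ (sym (Y-kept ¬cut)) (sym (Y-kept (λ cut → ¬cut (m≤n⇒m≤1+n cut))))
                      (down i j 1≤j j≤i i<n)
    -- (i, j) and (i + 1, j + 1) have the same offset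
    upY : ∀ i j → 1 ≤ j → j ≤ i → suc i ≤ n → Y i j ≤ Y (suc i) (suc j)
    upY i j 1≤j j≤i i<n with j + c ≤? i
    ... | yes cut = ≤-reflexive (trans (Y-cut cut) (sym (Y-cut {suc i} {suc j} (s≤s cut))))
    ... | no ¬cut = subst₂ _≤_ (sym (Y-kept ¬cut))
                      (sym (Y-kept {suc i} {suc j} (λ cut → ¬cut (≤-pred cut))))
                      (up i j 1≤j j≤i i<n)

  -- (n, n) has offset 0 < c and is kept.
  top : Y n n ≤ n
  top = subst (_≤ n) (sym (Y-kept (λ cut → <-irrefl refl (<-≤-trans (m<m+n n 1≤c) cut))))
          (proj₁ (proj₂ gog))

  summand-cut : ∀ js {i} → c ≤ i → summand Y js i ≡ + 0
  summand-cut js {i} c≤i =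
    cong₂ (λ a b → + a ℤ.- + b) (atOffset-cut (js i) c≤i) (atOffset-cut (js (suc i)) c≤i)

  summand-kept : ∀ js {i} → i < c → summand Y js i ≡ summand X js i
  summand-kept js {i} i<c =
    cong₂ (λ a b → + a ℤ.- + b) (atOffset-kept (js i) i<c) (atOffset-kept (js (suc i)) i<c)

  straightenedBound : ∀ r js (adm : Admissible n (n ∸ r) js) (c≤N : c ≤ n ∸ r) →
    gogamLHS n Y r js ℤ.≤ gogamLHS n X r (Straighten.js′ adm c≤N)
  straightenedBound r js adm c≤N = begin
    sumZ N (summand Y js) ℤ.+ final Y js N
      ≡⟨ cong₂ ℤ._+_ (sumZ-zeroTail (summand Y js) c≤N (λ i c≤i _ → summand-cut js c≤i))
                     (cong +_ (atOffset-cut (js N) c≤N)) ⟩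
    sumZ c (summand Y js) ℤ.+ + 1
      ≡⟨ cong (ℤ._+ + 1) (sumZ-cong c agree) ⟩
    sumZ c (summand X js′) ℤ.+ + 1
      ≤⟨ ℤP.+-mono-≤ (sumZ-nonnegTail (summand X js′) c≤N tailNonneg) (+≤+ finalPositive) ⟩
    sumZ N (summand X js′) ℤ.+ final X js′ N
      ∎
    where
    open ℤP.≤-Reasoning
    N = n ∸ r
    open Straighten adm c≤N
    module A′ = Admissible admissible
    agree : ∀ i → i < c → summand Y js i ≡ summand X js′ i
    agree i i<c = trans (summand-kept js i<c)
                        (summand-cong X {js} {js′} (sym (head (<⇒≤ i<c))) (sym (head i<c)))
    tailNonneg : ∀ i → c ≤ i → i < N → + 0 ℤ.≤ summand X js′ i
    tailNonneg i c≤i i<N =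
      unitStep-nonneg {js′} (unitStep c≤i i<N) (A′.columnPositive (suc i) i<N) (A′.inRows i (<⇒≤ i<N))
    finalPositive : 1 ≤ X (js′ N + N) (js′ N)
    finalPositive = positive _ _ A′.positive (m≤m+n (js′ N) N) (A′.inRows N ≤-refl)

  domination : Dominated n Y X
  domination r js adm with c ≤? n ∸ r
  ... | yes c≤N =
    Straighten.js′ adm c≤N , Straighten.admissible adm c≤N , straightenedBound r js adm c≤N
  ... | no  c≰N = js , adm , gogamLHS-mono n r js {X} {Y}
                               (λ i i<N → ℤP.≤-reflexive (summand-kept js (<-trans i<N N<c)))
                               (ℤP.≤-reflexive (cong +_ (atOffset-kept (js (n ∸ r)) N<c)))
    where
    N<c : n ∸ r < c
    N<c = ≰⇒> c≰N

  isGOGAm : IsGOGAm n Y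
  isGOGAm = inheritGOGAm gog isGT top domination

mainTheorem3 : (n : ℕ) (X : Triangle) → IsGOGAm n X →
    ((k : ℕ) → 1 ≤ k → k ≤ n → IsGOGAm n (cutTriangle k X)) ×
    ((m k : ℕ) → k ≤ m → m ≤ n → 1 ≤ k →
      ((i : ℕ) → 1 + m ≤ i → i ≤ n → (l : ℕ) → l ≤ n ∸ i → X (i + l) (k + l) ≡ X i k) →
      IsGOGAm n (diagReplace n m k X))
mainTheorem3 n X gog =
  (λ c 1≤c _ → Cut.isGOGAm gog 1≤c) ,
  (λ m k k≤m m≤n 1≤k constant → DiagonalReplacement.isGOGAm gog k≤m m≤n 1≤k constant)
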